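{- Let $k\ge2$ and $\sigma\in\{+,-\}^k$ be arbitrary; if $\sigma=-^k$, additionally assume $n\not\equiv2\pmod4$. Let $\pi\in\mathcal S_n$ be such that $\hat\pi\in\mathcal C^\sigma$. Then there exists a $\sigma$-segmentation of $\hat\pi$ such that the $\pi$-monotone word $s_1\dots s_n$ induced by it is primitive, and the word $s=(s_1\dots s_n)^\infty$ satisfies $\Pi_\sigma(s)=\pi$. Furthermore, if $\sigma=+^k$ or $\sigma=-^k$, then every $\sigma$-segmentation of $\hat\pi$ has this property.
   Context: Let $T^-_\sigma=\{t:\sigma_t=-\}$. Let $\mathcal W_k$ be the set of infinite words $s=s_1s_2\dots$ over $\{0,\dots,k-1\}$, $s_{[i,\infty)}=s_is_{i+1}\dots$. The order $\prec_\sigma$: for $s\ne t$, with $j$ the first index where $s_j\neq t_j$ and $c=|\{i<j:s_i\in T^-_\sigma\}|$, $s\prec_\sigma t$ iff ($c$ even and $s_j<t_j$) or ($c$ odd and $s_j>t_j$). A finite word is primitive if it is not a concatenation of two or more copies of a shorter word. For primitive $s_1\dots s_n$ and $s=(s_1\dots s_n)^\infty$, $\Pi_\sigma(s)\in\mathcal S_n$ is the permutation with $\Pi_\sigma(s)_i<\Pi_\sigma(s)_j$ iff $s_{[i,\infty)}\prec_\sigma s_{[j,\infty)}$. For $\pi\in\mathcal S_n$, $\hat\pi$ is the cyclic permutation $(\pi_1,\dots,\pi_n)$ in cycle notation, i.e. $\hat\pi_{\pi_i}=\pi_{i+1}$ with $\pi_{n+1}=\pi_1$. A $\sigma$-segmentation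 of $\tau\in\mathcal S_n$ is $0=e_0\le e_1\le\dots\le e_k=n$ such that each $\tau_{e_t+1}\dots\tau_{e_{t+1}}$ is increasing if $\sigma_t=+$ and decreasing if $\sigma_t=-$. $\mathcal C^\sigma$ is the set of cyclic permutations (single cycles) admitting a $\sigma$-segmentation. The $\pi$-monotone word induced by $e_0,\dots,e_k$ is the word $s_1\dots s_n$ with $s_i=t$ whenever $e_t<\pi_i\le e_{t+1}$. $+^k$ and $-^k$ denote the sign sequences with all entries $+$, respectively all entries $-$. -}

module Defs where

open import Data.Nat using (ℕ; zero; suc; _+_; _≤_; _<_; _>_; _%_; NonZero)
open import Data.Nat.DivMod using (_mod_)
open import Data.Fin as F using (Fin; toℕ; inject₁; fromℕ)
open import Data.Fin.Permutation using (Permutation′; _⟨$⟩ʳ_; _⟨$⟩ˡ_)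
open import Data.List using (List; tabulate; concat; replicate)
open import Data.Product using (Σ; _×_; ∃)
open import Data.Sum using (_⊎_)
open import Relation.Binary.PropositionalEquality using (_≡_)
open import Relation.Nullary using (¬_)
open import Function using (_∘_)
open import Function.Bundles using (_⇔_)

data Sign : Set where
  plus minus : Sign

-- sign sequences σ ∈ {+,-}^k, indexed by Fin k (index t = σ_t, 0-based)
SignSeq : ℕ → Set
SignSeq k = Fin k → Sign

AllPlus AllMinus : ∀ {k} → SignSeq k → Set
AllPlus  σ = ∀ t → σ t ≡ plus
AllMinus σ = ∀ t → σ t ≡ minus

-- infinite words over {0,…,k-1}, positions 0-based
InfWord : ℕ → Set
InfWord k = ℕ → Fin k

negCount : ∀ {k} → SignSeq k → InfWord k → ℕ → ℕ
negCount σ s zero = 0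
negCount σ s (suc j) with σ (s j)
... | plus  = negCount σ s j
... | minus = suc (negCount σ s j)

_≺[_]_ : ∀ {k} → InfWord k → SignSeq k → InfWord k → Set
s ≺[ σ ] t = ∃ λ j → (∀ i → i < j → s i ≡ t i) ×
  ((negCount σ s j % 2 ≡ 0 × toℕ (s j) < toℕ (t j)) ⊎
   (negCount σ s j % 2 ≡ 1 × toℕ (s j) > toℕ (t j)))

Word : ℕ → ℕ → Set
Word k n = Fin n → Fin k

Primitive : ∀ {k n} → Word k n → Set
Primitive {k} w = ¬ (Σ (List (Fin k)) λ u → Σ ℕ λ m → 2 ≤ m × tabulate w ≡ concat (replicate m u))

periodic : ∀ {k n} .{{_ : NonZero n}} → Word k n → InfWord k
periodic {n = n} w m = w (m mod n)

suffix : ∀ {k} → InfWord k → ℕ → InfWord k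
suffix s i m = s (i + m)

-- Π_σ(s) = π  (for primitive w, s = w^∞):  π_i < π_j ⇔ s_[i,∞) ≺_σ s_[j,∞)
PatternIs : ∀ {k n} .{{_ : NonZero n}} → SignSeq k → Word k n → Permutation′ n → Set
PatternIs {n = n} σ w π = ∀ (i j : Fin n) →
  (toℕ (π ⟨$⟩ʳ i) < toℕ (π ⟨$⟩ʳ j)) ⇔ (suffix (periodic w) (toℕ i) ≺[ σ ] suffix (periodic w) (toℕ j))

cycSuc : ∀ {n} .{{_ : NonZero n}} → Fin n → Fin n
cycSuc {n} i = suc (toℕ i) mod n

-- π̂ : the cycle (π_1, …, π_n), i.e. π̂(π_i) = π_{i+1}, π_{n+1} = π_1
hat : ∀ {n} .{{_ : NonZero n}} → Permutation′ n → Fin n → Fin n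
hat π v = π ⟨$⟩ʳ cycSuc (π ⟨$⟩ˡ v)

iter : ∀ {A : Set} → (A → A) → ℕ → A → A
iter f zero x = x
iter f (suc m) x = f (iter f m x)

IsCyclic : ∀ {n} → (Fin n → Fin n) → Set
IsCyclic {n} f = ∀ (i j : Fin n) → ∃ λ m → iter f m i ≡ j

-- σ-segmentation e_0 ≤ … ≤ e_k of τ (one-line notation, positions 0-based:
-- block t consists of positions p with e_t ≤ p < e_{t+1})
MonoBlock : ∀ {n} → Sign → (Fin n → Fin n) → Fin n → Fin n → Set
MonoBlock plus  τ p q = toℕ (τ p) < toℕ (τ q)
MonoBlock minus τ p q = toℕ (τ q) < toℕ (τ p)

IsSegmentation : ∀ {k n} → SignSeq k → (Fin n → Fin n) → (Fin (suc k) → ℕ) → Set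
IsSegmentation {k} {n} σ τ e =
  e F.zero ≡ 0 × e (fromℕ k) ≡ n ×
  (∀ (t : Fin k) → e (inject₁ t) ≤ e (F.suc t)) ×
  (∀ (t : Fin k) (p q : Fin n) → e (inject₁ t) ≤ toℕ p → toℕ p < toℕ q → toℕ q < e (F.suc t) →
     MonoBlock (σ t) τ p q)

InC : ∀ {k n} → SignSeq k → (Fin n → Fin n) → Set
InC σ τ = IsCyclic τ × ∃ λ e → IsSegmentation σ τ e

-- w is the π-monotone word induced by e: s_i = t whenever e_t < π_i ≤ e_{t+1}
-- (1-based values; here π_i is 0-based, so e_t ≤ π_i < e_{t+1})
IsInducedWord : ∀ {k n} → Permutation′ n → (Fin (suc k) → ℕ) → Word k n → Set
IsInducedWord {k} {n} π e w = ∀ (i : Fin n) (t : Fin k) →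
  e (inject₁ t) ≤ toℕ (π ⟨$⟩ʳ i) → toℕ (π ⟨$⟩ʳ i) < e (F.suc t) → w i ≡ t

-- Write rank x = π(x mod n) and letter x = s(x mod n) for positions x of s^∞. Since π̂ sends
-- π(x) to π(x+1) and is monotone on every block, two positions with the same letter keep
-- (sign +) or swap (sign −) their rank order one step later; along a common prefix the order
-- is thus transported by the product of the letter signs, which is exactly the parity rule
-- of ≺_σ. Hence Π_σ(s^∞) = π, and s is primitive, as soon as the letters have no period
-- D ≢ 0 (mod n). Such a period must have sign −: starting where rank (x + D) = 0 < rank x,
-- a period of sign + would give rank (x + 2D) < 0. So 2D has sign + and is a multiple of n,
-- i.e. n = 2r with r a period of sign −. This is impossible for σ = +^k, and for σ = −^k it
-- forces r odd, i.e. n ≡ 2 (mod 4). For mixed σ, if s has period n/2 one moves a single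
-- boundary by one place (next to an empty block, or at a sign change, towards the block
-- whose sign agrees with π̂ on the two boundary positions); the moved value and its partner
-- n/2 positions away then get different letters, which kills the period.

module Submission where

open import Defs
open import Data.Nat
open import Data.Nat.Properties
open import Data.Nat.DivMod
open import Data.Nat.Divisibility using (divides)
open import Data.Nat.Solver using (module +-*-Solver)
open import Data.Fin as F using (Fin; toℕ; inject₁; fromℕ; fromℕ<)
open import Data.Fin.Properties as FinP
  using ( toℕ-injective; toℕ-fromℕ<; toℕ<n; toℕ-inject₁; toℕ-fromℕ; inject₁-injective; fromℕ≢inject₁
        ; any?; all?; ¬∀⟶∃¬)
open import Data.Fin.Permutation using (Permutation′; _⟨$⟩ʳ_; _⟨$⟩ˡ_; inverseˡ; inverseʳ)
open import Data.Vec.Functional using (updateAt)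
open import Data.Vec.Functional.Properties using (updateAt-updates; updateAt-minimal)
open import Data.List using (List; []; _∷_; _++_; length; tabulate; concat; replicate)
open import Data.List.Properties using (length-tabulate; length-++)
open import Data.Maybe using (Maybe; just; nothing)
open import Data.Maybe.Properties using (just-injective)
open import Data.Product using (Σ; ∃; _×_; _,_; proj₁; proj₂; map₂)
open import Data.Sum using (_⊎_; inj₁; inj₂; [_,_]′)
open import Data.Empty using (⊥; ⊥-elim)
open import Function using (_∘_; const)
open import Function.Bundles using (mk⇔)
open import Relation.Binary.PropositionalEquality
open import Relation.Binary.Definitions using (tri<; tri≈; tri>)
open import Relation.Nullary
open import Relation.Nullary.Decidable using (¬?; decidable-stable)

infixl 7 _·_

_·_ : Sign → Sign → Sign
plus  · s     = s
minus · plus  = minus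
minus · minus = plus

·-identityʳ : ∀ s → s · plus ≡ s
·-identityʳ plus  = refl
·-identityʳ minus = refl

·-comm : ∀ a b → a · b ≡ b · a
·-comm plus  plus  = refl
·-comm plus  minus = refl
·-comm minus plus  = refl
·-comm minus minus = refl

·-assoc : ∀ a b c → (a · b) · c ≡ a · (b · c)
·-assoc plus  b     c     = refl
·-assoc minus plus  c     = refl
·-assoc minus minus plus  = refl
·-assoc minus minus minus = refl

·-inverse : ∀ s → s · s ≡ plus
·-inverse plus  = refl
·-inverse minus = refl

·-cancelˡ : ∀ a b c → a · b ≡ a · c → b ≡ c
·-cancelˡ plus  b c eq = eq
·-cancelˡ minus plus  plus  eq = refl
·-cancelˡ minus minus minus eq = refl

_≟ˢ_ : (a b : Sign) → Dec (a ≡ b)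
plus  ≟ˢ plus  = yes refl
plus  ≟ˢ minus = no λ ()
minus ≟ˢ plus  = no λ ()
minus ≟ˢ minus = yes refl

plus≢minus : plus ≢ minus
plus≢minus ()

≢plus⇒≡minus : ∀ {s} → s ≢ plus → s ≡ minus
≢plus⇒≡minus {plus}  ne = ⊥-elim (ne refl)
≢plus⇒≡minus {minus} ne = refl

≢minus⇒≡plus : ∀ {s} → s ≢ minus → s ≡ plus
≢minus⇒≡plus {plus}  ne = refl
≢minus⇒≡plus {minus} ne = ⊥-elim (ne refl)

_<[_]_ : ℕ → Sign → ℕ → Set
a <[ plus  ] b = a < b
a <[ minus ] b = b < a

<[]-trans : ∀ s {a b c} → a <[ s ] b → b <[ s ] c → a <[ s ] c
<[]-trans plus  ab bc = <-trans ab bc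
<[]-trans minus ab bc = <-trans bc ab

<[]-flip : ∀ s {a b} → a <[ s ] b → b <[ minus · s ] a
<[]-flip plus  ab = ab
<[]-flip minus ab = ab

<[]-total : ∀ s s′ {a b} → s ≢ s′ → a ≢ b → a <[ s ] b ⊎ a <[ s′ ] b
<[]-total plus  plus  s≢s′ _ = ⊥-elim (s≢s′ refl)
<[]-total minus minus s≢s′ _ = ⊥-elim (s≢s′ refl)
<[]-total plus  minus {a} {b} _ a≢b with <-cmp a b
... | tri< a<b _ _ = inj₁ a<b
... | tri≈ _ a≡b _ = ⊥-elim (a≢b a≡b)
... | tri> _ _ b<a = inj₂ b<a
<[]-total minus plus  {a} {b} _ a≢b with <-cmp a b
... | tri< a<b _ _ = inj₂ a<b
... | tri≈ _ a≡b _ = ⊥-elim (a≢b a≡b)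
... | tri> _ _ b<a = inj₁ b<a

MonoBlock⇒<[] : ∀ {n} s (τ : Fin n → Fin n) p q → MonoBlock s τ p q → toℕ (τ p) <[ s ] toℕ (τ q)
MonoBlock⇒<[] plus  τ p q m = m
MonoBlock⇒<[] minus τ p q m = m

<[]⇒MonoBlock : ∀ {n} s (τ : Fin n → Fin n) p q → toℕ (τ p) <[ s ] toℕ (τ q) → MonoBlock s τ p q
<[]⇒MonoBlock plus  τ p q m = m
<[]⇒MonoBlock minus τ p q m = m

minus^_ : ℕ → Sign
minus^ zero    = plus
minus^ (suc c) = minus · minus^ c

minus^-negCount-suc : ∀ {k} (σ : SignSeq k) (s : InfWord k) m →
  minus^ (negCount σ s (suc m)) ≡ minus^ (negCount σ s m) · σ (s m)
minus^-negCount-suc σ s m with σ (s m)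
... | plus  = sym (·-identityʳ _)
... | minus = ·-comm minus _

minus^-+2 : ∀ c → minus^ (2 + c) ≡ minus^ c
minus^-+2 c = sym (·-assoc minus minus (minus^ c))

minus^≡plus⇒even : ∀ c → minus^ c ≡ plus → c % 2 ≡ 0
minus^≡plus⇒even zero          eq = refl
minus^≡plus⇒even (suc (suc c)) eq = minus^≡plus⇒even c (trans (sym (minus^-+2 c)) eq)

minus^≡minus⇒odd : ∀ c → minus^ c ≡ minus → c % 2 ≡ 1
minus^≡minus⇒odd (suc zero)    eq = refl
minus^≡minus⇒odd (suc (suc c)) eq = minus^≡minus⇒odd c (trans (sym (minus^-+2 c)) eq)

odd⇒[m+m]%4≡2 : ∀ r → r % 2 ≡ 1 → (r + r) % 4 ≡ 2
odd⇒[m+m]%4≡2 r odd = trans (cong (_% 4) (trans (cong₂ _+_ r≡ r≡) (double (r / 2))))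
                            ([m+kn]%n≡m%n 2 (r / 2) 4)
  where
  open +-*-Solver
  r≡ : r ≡ 1 + r / 2 * 2
  r≡ = trans (m≡m%n+[m/n]*n r 2) (cong (_+ r / 2 * 2) odd)
  double : ∀ q → (1 + q * 2) + (1 + q * 2) ≡ 2 + q * 4
  double = solve 1 (λ q → (con 1 :+ q :* con 2) :+ (con 1 :+ q :* con 2) := con 2 :+ q :* con 4) refl

m<n+n∧m%n≡0⇒m≡0⊎m≡n : ∀ n .{{_ : NonZero n}} m → m < n + n → m % n ≡ 0 → m ≡ 0 ⊎ m ≡ n
m<n+n∧m%n≡0⇒m≡0⊎m≡n n m m<2n m%n≡0 with m <? n
... | yes m<n = inj₁ (trans (sym (m<n⇒m%n≡m m<n)) m%n≡0)
... | no  m≮n = inj₂ (begin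
    m           ≡⟨ m∸n+n≡m n≤m ⟨
    (m ∸ n) + n ≡⟨ cong (_+ n) m∸n≡0 ⟩
    n           ∎)
  where
  open ≡-Reasoning
  n≤m = ≮⇒≥ m≮n
  m∸n<n : m ∸ n < n
  m∸n<n = +-cancelʳ-< _ _ _ (subst (_< n + n) (sym (m∸n+n≡m n≤m)) m<2n)
  m∸n≡0 : m ∸ n ≡ 0
  m∸n≡0 = begin
    m ∸ n           ≡⟨ m<n⇒m%n≡m m∸n<n ⟨
    (m ∸ n) % n     ≡⟨ [m+n]%n≡m%n (m ∸ n) n ⟨
    (m ∸ n + n) % n ≡⟨ cong (_% n) (m∸n+n≡m n≤m) ⟩
    m % n           ≡⟨ m%n≡0 ⟩
    0               ∎

[m+n%d]%d≡[m+n]%d : ∀ m n d .{{_ : NonZero d}} → (m + n % d) % d ≡ (m + n) % d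
[m+n%d]%d≡[m+n]%d m n d = begin
    (m + n % d) % d         ≡⟨ %-distribˡ-+ m (n % d) d ⟩
    (m % d + n % d % d) % d ≡⟨ cong (λ z → (m % d + z) % d) (m%n%n≡m%n n d) ⟩
    (m % d + n % d) % d     ≡⟨ %-distribˡ-+ m n d ⟨
    (m + n) % d             ∎
  where open ≡-Reasoning

[m+n]%d≡[o+n]%d : ∀ m o n d .{{_ : NonZero d}} → m % d ≡ o % d → (m + n) % d ≡ (o + n) % d
[m+n]%d≡[o+n]%d m o n d eq = begin
    (m + n) % d         ≡⟨ %-distribˡ-+ m n d ⟩
    (m % d + n % d) % d ≡⟨ cong (λ z → (z + n % d) % d) eq ⟩
    (o % d + n % d) % d ≡⟨ %-distribˡ-+ o n d ⟨
    (o + n) % d         ∎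
  where open ≡-Reasoning

-- Adding n ∸ (x % n) to both sides of x % n ≡ (x + E) % n leaves E % n ≡ 0.
E%n≢0⇒x%n≢[x+E]%n : ∀ n .{{_ : NonZero n}} x E → E % n ≢ 0 → x % n ≢ (x + E) % n
E%n≢0⇒x%n≢[x+E]%n n x E E%n≢0 eq = E%n≢0 (begin
    E % n                         ≡⟨ m%n%n≡m%n E n ⟨
    E % n % n                     ≡⟨ [m+n]%n≡m%n (E % n) n ⟨
    (E % n + n) % n               ≡⟨ cong (_% n) (+-comm (E % n) n) ⟩
    (n + E % n) % n               ≡⟨ cong (λ z → (z + E % n) % n) (m∸n+n≡m a≤n) ⟨
    (n ∸ a + a + E % n) % n       ≡⟨ cong (_% n) (+-assoc (n ∸ a) a (E % n)) ⟩
    (n ∸ a + (a + E % n)) % n     ≡⟨ [m+n%d]%d≡[m+n]%d (n ∸ a) (a + E % n) n ⟨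
    (n ∸ a + (a + E % n) % n) % n ≡⟨ cong (λ z → (n ∸ a + z) % n) a+E≡a ⟩
    (n ∸ a + a % n) % n           ≡⟨ [m+n%d]%d≡[m+n]%d (n ∸ a) a n ⟩
    (n ∸ a + a) % n               ≡⟨ cong (_% n) (m∸n+n≡m a≤n) ⟩
    n % n                         ≡⟨ n%n≡0 n ⟩
    0                             ∎)
  where
  open ≡-Reasoning
  a = x % n
  a≤n : a ≤ n
  a≤n = <⇒≤ (m%n<n x n)
  a+E≡a : (a + E % n) % n ≡ a % n
  a+E≡a = begin
    (x % n + E % n) % n ≡⟨ %-distribˡ-+ x E n ⟨
    (x + E) % n         ≡⟨ eq ⟨
    x % n               ≡⟨ m%n%n≡m%n x n ⟨
    x % n % n           ∎

toℕ-mod : ∀ n .{{_ : NonZero n}} m → toℕ (m mod n) ≡ m % n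
toℕ-mod n m = toℕ-fromℕ< _

%≡⇒mod≡ : ∀ n .{{_ : NonZero n}} a b → a % n ≡ b % n → a mod n ≡ b mod n
%≡⇒mod≡ n a b eq = toℕ-injective (trans (toℕ-mod n a) (trans eq (sym (toℕ-mod n b))))

toℕ-mod-inverse : ∀ n .{{_ : NonZero n}} (i : Fin n) → toℕ i mod n ≡ i
toℕ-mod-inverse n i = toℕ-injective (trans (toℕ-mod n (toℕ i)) (m<n⇒m%n≡m (toℕ<n i)))

m+m≡n⇒m<n : ∀ n .{{_ : NonZero n}} m → n ≡ m + m → m < n
m+m≡n⇒m<n n m n≡m+m = subst (m <_) (sym n≡m+m) (subst (_< m + m) (+-identityʳ m) (+-monoʳ-< m 0<m))
  where
  0<m : 0 < m
  0<m = n≢0⇒n>0 λ m≡0 → ≢-nonZero⁻¹ n (trans n≡m+m (cong₂ _+_ m≡0 m≡0))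

m+m≡n⇒m%n≢0 : ∀ n .{{_ : NonZero n}} m → n ≡ m + m → m % n ≢ 0
m+m≡n⇒m%n≢0 n m n≡m+m m%n≡0 = ≢-nonZero⁻¹ n (trans n≡m+m (cong₂ _+_ m≡0 m≡0))
  where
  m≡0 : m ≡ 0
  m≡0 = trans (sym (m<n⇒m%n≡m (m+m≡n⇒m<n n m n≡m+m))) m%n≡0

m+m≡n⇒m≡n/2 : ∀ n m → n ≡ m + m → m ≡ n / 2
m+m≡n⇒m≡n/2 n m n≡m+m = sym (trans (cong (_/ 2) n≡m*2) (m*n/n≡m m 2))
  where
  n≡m*2 : n ≡ m * 2
  n≡m*2 = trans n≡m+m (trans (cong (m +_) (sym (+-identityʳ m))) (*-comm 2 m))

[n∸a+b]%n≢0 : ∀ n .{{_ : NonZero n}} a b → a < n → b < n → a ≢ b → (n ∸ a + b) % n ≢ 0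
[n∸a+b]%n≢0 n a b a<n b<n a≢b D%n≡0
  with m<n+n∧m%n≡0⇒m≡0⊎m≡n n (n ∸ a + b) (+-mono-≤-< (m∸n≤m n a) b<n) D%n≡0
... | inj₁ D≡0 = >⇒≢ (m<n⇒0<n∸m a<n) (m+n≡0⇒m≡0 (n ∸ a) D≡0)
... | inj₂ D≡n = a≢b (sym (+-cancelˡ-≡ (n ∸ a) b a (trans D≡n (sym (m∸n+n≡m (<⇒≤ a<n))))))

OrderedAt : ∀ {k} → SignSeq k → InfWord k → InfWord k → ℕ → Set
OrderedAt σ s t j =
  (negCount σ s j % 2 ≡ 0 × toℕ (s j) < toℕ (t j)) ⊎ (negCount σ s j % 2 ≡ 1 × toℕ (s j) > toℕ (t j))

OrderedAt⇒≢ : ∀ {k} (σ : SignSeq k) (s t : InfWord k) j → OrderedAt σ s t j → s j ≢ t j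
OrderedAt⇒≢ σ s t j (inj₁ (_ , lt)) eq = <-irrefl (cong toℕ eq) lt
OrderedAt⇒≢ σ s t j (inj₂ (_ , gt)) eq = <-irrefl (cong toℕ (sym eq)) gt

OrderedAt-asym : ∀ {k} (σ : SignSeq k) (s t : InfWord k) j → negCount σ s j ≡ negCount σ t j →
  OrderedAt σ s t j → OrderedAt σ t s j → ⊥
OrderedAt-asym σ s t j c≡ (inj₁ (_ , lt)) (inj₁ (_ , gt)) = <-asym lt gt
OrderedAt-asym σ s t j c≡ (inj₂ (_ , gt)) (inj₂ (_ , lt)) = <-asym lt gt
OrderedAt-asym σ s t j c≡ (inj₁ (even , _)) (inj₂ (odd , _))
  with () ← trans (sym even) (trans (cong (_% 2) c≡) odd)
OrderedAt-asym σ s t j c≡ (inj₂ (odd , _)) (inj₁ (even , _))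
  with () ← trans (sym odd) (trans (cong (_% 2) c≡) even)

negCount-agree : ∀ {k} (σ : SignSeq k) (s t : InfWord k) j →
  (∀ l → l < j → s l ≡ t l) → negCount σ s j ≡ negCount σ t j
negCount-agree σ s t zero    ag = refl
negCount-agree σ s t (suc j) ag
  with ag j (n<1+n j) | negCount-agree σ s t j (λ l l<j → ag l (m<n⇒m<1+n l<j))
... | sj≡tj | c≡ rewrite sj≡tj with σ (t j)
...   | plus  = c≡
...   | minus = cong suc c≡

≺-irrefl : ∀ {k} (σ : SignSeq k) (s : InfWord k) → ¬ (s ≺[ σ ] s)
≺-irrefl σ s (j , _ , ord) = OrderedAt⇒≢ σ s s j ord refl

≺-asym : ∀ {k} (σ : SignSeq k) (s t : InfWord k) → s ≺[ σ ] t → ¬ (t ≺[ σ ] s)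
≺-asym σ s t (j₁ , ag₁ , ord₁) (j₂ , ag₂ , ord₂) with <-cmp j₁ j₂
... | tri< lt _ _   = OrderedAt⇒≢ σ s t j₁ ord₁ (sym (ag₂ j₁ lt))
... | tri> _ _ gt   = OrderedAt⇒≢ σ t s j₂ ord₂ (sym (ag₁ j₂ gt))
... | tri≈ _ refl _ = OrderedAt-asym σ s t j₁ (negCount-agree σ s t j₁ ag₁) ord₁ ord₂

first-difference : ∀ {k} (s t : InfWord k) N →
  (∀ l → l < N → s l ≡ t l) ⊎ (∃ λ m → (∀ l → l < m → s l ≡ t l) × s m ≢ t m)
first-difference s t zero = inj₁ λ l ()
first-difference s t (suc N) with first-difference s t N
... | inj₂ diff = inj₂ diff
... | inj₁ ag with s N F.≟ t N
...   | no  sN≢tN = inj₂ (N , ag , sN≢tN)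
...   | yes sN≡tN =
  inj₁ λ l l<1+N → [ ag l , (λ { refl → sN≡tN }) ]′ (m≤n⇒m<n∨m≡n (s≤s⁻¹ l<1+N))

at : ∀ {A : Set} → List A → ℕ → Maybe A
at []       _       = nothing
at (x ∷ xs) zero    = just x
at (x ∷ xs) (suc i) = at xs i

at-tabulate : ∀ {A : Set} {n} (f : Fin n → A) i (i<n : i < n) → at (tabulate f) i ≡ just (f (fromℕ< i<n))
at-tabulate {n = suc n} f zero    i<n = refl
at-tabulate {n = suc n} f (suc i) i<n = at-tabulate (λ j → f (F.suc j)) i (s≤s⁻¹ i<n)

at-++ˡ : ∀ {A : Set} (xs ys : List A) i → i < length xs → at (xs ++ ys) i ≡ at xs i
at-++ˡ (x ∷ xs) ys zero    i<n = refl
at-++ˡ (x ∷ xs) ys (suc i) i<n = at-++ˡ xs ys i (s≤s⁻¹ i<n)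

at-++ʳ : ∀ {A : Set} (xs ys : List A) i → at (xs ++ ys) (length xs + i) ≡ at ys i
at-++ʳ []       ys i = refl
at-++ʳ (x ∷ xs) ys i = at-++ʳ xs ys i

length-concat-replicate : ∀ {A : Set} m (xs : List A) → length (concat (replicate m xs)) ≡ m * length xs
length-concat-replicate zero    xs = refl
length-concat-replicate (suc m) xs = trans (length-++ xs) (cong (length xs +_) (length-concat-replicate m xs))

at-concat-replicate : ∀ {A : Set} m (xs : List A) .{{_ : NonZero (length xs)}} i → i < m * length xs →
  at (concat (replicate m xs)) i ≡ at xs (i % length xs)
at-concat-replicate (suc m) xs i i<len with i <? length xs
... | yes i<L = trans (at-++ˡ xs _ i i<L) (cong (at xs) (sym (m<n⇒m%n≡m i<L)))
... | no  i≮L = begin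
    at (xs ++ concat (replicate m xs)) i       ≡⟨ cong (at (xs ++ _)) L+i′≡i ⟨
    at (xs ++ concat (replicate m xs)) (L + i′) ≡⟨ at-++ʳ xs _ i′ ⟩
    at (concat (replicate m xs)) i′            ≡⟨ at-concat-replicate m xs i′ i′<len ⟩
    at xs (i′ % L)                            ≡⟨ cong (at xs) i′%L≡i%L ⟩
    at xs (i % L)                             ∎
  where
  open ≡-Reasoning
  L  = length xs
  i′ = i ∸ L
  L+i′≡i : L + i′ ≡ i
  L+i′≡i = m+[n∸m]≡n (≮⇒≥ i≮L)
  i′<len : i′ < m * L
  i′<len = +-cancelˡ-< L _ _ (subst (_< L + m * L) (sym L+i′≡i) i<len)
  i′%L≡i%L : i′ % L ≡ i % L
  i′%L≡i%L = trans (sym ([m+n]%n≡m%n i′ L)) (cong (_% L) (trans (+-comm i′ L) L+i′≡i))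

-- rank x is the intended rank of the suffix of s^∞ starting at position x.
module Rank {n : ℕ} .{{_ : NonZero n}} (π : Permutation′ n) where

  rank : ℕ → ℕ
  rank x = toℕ (π ⟨$⟩ʳ (x mod n))

  rank<n : ∀ x → rank x < n
  rank<n x = toℕ<n _

  rank-toℕ : ∀ (i : Fin n) → rank (toℕ i) ≡ toℕ (π ⟨$⟩ʳ i)
  rank-toℕ i = cong (λ j → toℕ (π ⟨$⟩ʳ j)) (toℕ-mod-inverse n i)

  rank-cong : ∀ a b → a % n ≡ b % n → rank a ≡ rank b
  rank-cong a b eq = cong (λ i → toℕ (π ⟨$⟩ʳ i)) (%≡⇒mod≡ n a b eq)

  rank-injective : ∀ a b → rank a ≡ rank b → a % n ≡ b % n
  rank-injective a b eq = trans (sym (toℕ-mod n a)) (trans (cong toℕ a≡b) (toℕ-mod n b))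
    where
    a≡b : a mod n ≡ b mod n
    a≡b = trans (sym (inverseˡ π)) (trans (cong (π ⟨$⟩ˡ_) (toℕ-injective eq)) (inverseˡ π))

  rank-+-≢ : ∀ x E → E % n ≢ 0 → rank x ≢ rank (x + E)
  rank-+-≢ x E E%n≢0 eq = E%n≢0⇒x%n≢[x+E]%n n x E E%n≢0 (rank-injective x (x + E) eq)

  hat-rank : ∀ x → hat π (π ⟨$⟩ʳ (x mod n)) ≡ π ⟨$⟩ʳ (suc x mod n)
  hat-rank x = cong (π ⟨$⟩ʳ_) (trans (cong cycSuc (inverseˡ π))
    (%≡⇒mod≡ n _ _ (trans (cong (λ z → suc z % n) (toℕ-mod n x)) ([m+n%d]%d≡[m+n]%d 1 x n))))

  bottom : ℕ
  bottom = toℕ (π ⟨$⟩ˡ (0 mod n))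

  rank-bottom : rank bottom ≡ 0
  rank-bottom = trans (rank-toℕ (π ⟨$⟩ˡ (0 mod n)))
    (trans (cong toℕ (inverseʳ π)) (trans (toℕ-mod n 0) (m<n⇒m%n≡m (>-nonZero⁻¹ n))))

Ascending : ∀ {k} → (Fin (suc k) → ℕ) → Set
Ascending {k} e = ∀ (t : Fin k) → e (inject₁ t) ≤ e (F.suc t)

InBlock : ∀ {k} → (Fin (suc k) → ℕ) → Fin k → ℕ → Set
InBlock e t v = e (inject₁ t) ≤ v × v < e (F.suc t)

Ascending-mono : ∀ {k} (e : Fin (suc k) → ℕ) → Ascending e → ∀ a b → toℕ a ≤ toℕ b → e a ≤ e b
Ascending-mono         e asc F.zero    F.zero    _         = ≤-refl
Ascending-mono {suc k} e asc F.zero    (F.suc b) _         =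
  ≤-trans (asc F.zero) (Ascending-mono (λ i → e (F.suc i)) (λ t → asc (F.suc t)) F.zero b z≤n)
Ascending-mono {suc k} e asc (F.suc a) (F.suc b) (s≤s a≤b) =
  Ascending-mono (λ i → e (F.suc i)) (λ t → asc (F.suc t)) a b a≤b

Ascending-suc≤inject₁ : ∀ {k} (e : Fin (suc k) → ℕ) → Ascending e → ∀ {t u : Fin k} →
  toℕ u < toℕ t → e (F.suc u) ≤ e (inject₁ t)
Ascending-suc≤inject₁ e asc {t} {u} u<t =
  Ascending-mono e asc (F.suc u) (inject₁ t) (subst (suc (toℕ u) ≤_) (sym (toℕ-inject₁ t)) u<t)

InBlock-mono : ∀ {k} (e : Fin (suc k) → ℕ) → Ascending e → ∀ {t u v v′} →
  InBlock e t v → InBlock e u v′ → v ≤ v′ → toℕ t ≤ toℕ u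
InBlock-mono e asc (lo , _) (_ , hi′) v≤v′ =
  ≮⇒≥ λ u<t → <-irrefl refl
    (<-≤-trans hi′ (≤-trans (Ascending-suc≤inject₁ e asc u<t) (≤-trans lo v≤v′)))

InBlock-unique : ∀ {k} (e : Fin (suc k) → ℕ) → Ascending e → ∀ {t u v} →
  InBlock e t v → InBlock e u v → t ≡ u
InBlock-unique e asc t∋v u∋v =
  toℕ-injective (≤-antisym (InBlock-mono e asc t∋v u∋v ≤-refl) (InBlock-mono e asc u∋v t∋v ≤-refl))

∃-InBlock : ∀ {k} (e : Fin (suc k) → ℕ) → Ascending e → ∀ v → e F.zero ≤ v → v < e (fromℕ k) →
  ∃ λ t → InBlock e t v
∃-InBlock {zero}  e asc v lo hi = ⊥-elim (<-irrefl refl (≤-<-trans lo hi))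
∃-InBlock {suc k} e asc v lo hi with v <? e (F.suc F.zero)
... | yes v<e₁ = F.zero , lo , v<e₁
... | no  v≮e₁ with ∃-InBlock (λ i → e (F.suc i)) (λ t → asc (F.suc t)) v (≮⇒≥ v≮e₁) hi
...   | t , t∋v = F.suc t , t∋v

module Segmentation {k n} (σ : SignSeq k) (τ : Fin n → Fin n) (e : Fin (suc k) → ℕ)
  (seg : IsSegmentation σ τ e) where

  segmentation-ascending : Ascending e
  segmentation-ascending = proj₁ (proj₂ (proj₂ seg))

  segmentation-monotone : ∀ t p q → e (inject₁ t) ≤ toℕ p → toℕ p < toℕ q → toℕ q < e (F.suc t) →
    MonoBlock (σ t) τ p q
  segmentation-monotone = proj₂ (proj₂ (proj₂ seg))

  segmentation-covers : ∀ v → v < n → ∃ λ t → InBlock e t v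
  segmentation-covers v v<n = ∃-InBlock e segmentation-ascending v
    (subst (_≤ v) (sym (proj₁ seg)) z≤n) (subst (v <_) (sym (proj₁ (proj₂ seg))) v<n)

  InBlock⇒<n : ∀ {t v} → InBlock e t v → v < n
  InBlock⇒<n {t} (_ , hi) = <-≤-trans hi (subst (e (F.suc t) ≤_) (proj₁ (proj₂ seg))
    (Ascending-mono e segmentation-ascending (F.suc t) (fromℕ k)
      (subst (suc (toℕ t) ≤_) (sym (toℕ-fromℕ k)) (toℕ<n t))))

module Segmented {k n : ℕ} .{{_ : NonZero n}} (σ : SignSeq k) (π : Permutation′ n)
  (e : Fin (suc k) → ℕ) (seg : IsSegmentation σ (hat π) e)
  (w : Word k n) (ind : IsInducedWord π e w) where

  open Rank π public
  open Segmentation σ (hat π) e seg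

  letter : ℕ → Fin k
  letter x = w (x mod n)

  rank∈block : ∀ x → InBlock e (letter x) (rank x)
  rank∈block x with segmentation-covers (rank x) (rank<n x)
  ... | t , lo , hi = subst (λ u → InBlock e u (rank x)) (sym (ind (x mod n) t lo hi)) (lo , hi)

  letter-mono : ∀ x y → rank x ≤ rank y → toℕ (letter x) ≤ toℕ (letter y)
  letter-mono x y = InBlock-mono e segmentation-ascending (rank∈block x) (rank∈block y)

  -- π̂ sends rank x to rank (suc x) and is monotone of sign σ t on block t.
  rank-step : ∀ x y → letter x ≡ letter y → rank x < rank y →
    rank (suc x) <[ σ (letter x) ] rank (suc y)
  rank-step x y eq lt = subst₂ (_<[ σ (letter x) ]_) (cong toℕ (hat-rank x)) (cong toℕ (hat-rank y))
    (MonoBlock⇒<[] (σ (letter x)) (hat π) _ _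
      (segmentation-monotone (letter x) _ _ (proj₁ (rank∈block x)) lt
        (subst (λ u → rank y < e (F.suc u)) (sym eq) (proj₂ (rank∈block y)))))

  rank-step-oriented : ∀ o x y → letter x ≡ letter y → rank x <[ o ] rank y →
    rank (suc x) <[ o · σ (letter x) ] rank (suc y)
  rank-step-oriented plus  x y eq r = rank-step x y eq r
  rank-step-oriented minus x y eq r = subst (λ u → rank (suc x) <[ minus · σ u ] rank (suc y)) (sym eq)
    (<[]-flip (σ (letter y)) (rank-step y x (sym eq) r))

  windowSign : ℕ → ℕ → Sign
  windowSign x zero    = plus
  windowSign x (suc L) = windowSign x L · σ (letter (x + L))

  minus^-negCount : ∀ x m → minus^ (negCount σ (suffix (periodic w) x) m) ≡ windowSign x m
  minus^-negCount x zero    = refl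
  minus^-negCount x (suc m) = trans (minus^-negCount-suc σ (suffix (periodic w) x) m)
    (cong (_· σ (letter (x + m))) (minus^-negCount x m))

  rank-step-along : ∀ o x y L → (∀ l → l < L → letter (x + l) ≡ letter (y + l)) →
    rank x <[ o ] rank y → rank (x + L) <[ o · windowSign x L ] rank (y + L)
  rank-step-along o x y zero ag r =
    subst (λ s → rank (x + 0) <[ s ] rank (y + 0)) (sym (·-identityʳ o))
      (subst₂ (λ a b → rank a <[ o ] rank b) (sym (+-identityʳ x)) (sym (+-identityʳ y)) r)
  rank-step-along o x y (suc L) ag r =
    subst₂ (λ a b → rank a <[ o · windowSign x (suc L) ] rank b) (sym (+-suc x L)) (sym (+-suc y L))
      (subst (λ s → rank (suc (x + L)) <[ s ] rank (suc (y + L))) (·-assoc o (windowSign x L) _)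
        (rank-step-oriented (o · windowSign x L) (x + L) (y + L) (ag L (n<1+n L))
          (rank-step-along o x y L (λ l l<L → ag l (m<n⇒m<1+n l<L)) r)))

  windowSign-+ : ∀ x L₁ L₂ → windowSign x (L₁ + L₂) ≡ windowSign x L₁ · windowSign (x + L₁) L₂
  windowSign-+ x L₁ zero = trans (cong (windowSign x) (+-identityʳ L₁)) (sym (·-identityʳ _))
  windowSign-+ x L₁ (suc L₂) = begin
    windowSign x (L₁ + suc L₂)
      ≡⟨ cong (windowSign x) (+-suc L₁ L₂) ⟩
    windowSign x (L₁ + L₂) · σ (letter (x + (L₁ + L₂)))
      ≡⟨ cong₂ _·_ (windowSign-+ x L₁ L₂) (cong (σ ∘ letter) (sym (+-assoc x L₁ L₂))) ⟩
    windowSign x L₁ · windowSign (x + L₁) L₂ · σ (letter (x + L₁ + L₂))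
      ≡⟨ ·-assoc (windowSign x L₁) _ _ ⟩
    windowSign x L₁ · windowSign (x + L₁) (suc L₂)
      ∎
    where open ≡-Reasoning

  IsPeriod : ℕ → Set
  IsPeriod E = ∀ x → letter (x + E) ≡ letter x

  period-+ : ∀ {D E} → IsPeriod D → IsPeriod E → IsPeriod (D + E)
  period-+ {D} {E} pD pE x = trans (cong letter (sym (+-assoc x D E))) (trans (pE (x + D)) (pD x))

  period-shift : ∀ {E} → IsPeriod E → ∀ x l → letter (x + E + l) ≡ letter (x + l)
  period-shift {E} p x l = trans (cong letter x+E+l≡x+l+E) (p (x + l))
    where
    x+E+l≡x+l+E : x + E + l ≡ x + l + E
    x+E+l≡x+l+E = trans (+-assoc x E l) (trans (cong (x +_) (+-comm E l)) (sym (+-assoc x l E)))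

  windowSign-period : ∀ {E} → IsPeriod E → ∀ x L → windowSign (x + E) L ≡ windowSign x L
  windowSign-period p x zero    = refl
  windowSign-period p x (suc L) = cong₂ _·_ (windowSign-period p x L) (cong σ (period-shift p x L))

  windowSign-shift : ∀ {E} → IsPeriod E → ∀ x → windowSign (suc x) E ≡ windowSign x E
  windowSign-shift {E} p x = ·-cancelˡ (windowSign x 1) _ _ (begin
    windowSign x 1 · windowSign (suc x) E  ≡⟨ cong (λ z → windowSign x 1 · windowSign z E) (+-comm 1 x) ⟩
    windowSign x 1 · windowSign (x + 1) E  ≡⟨ windowSign-+ x 1 E ⟨
    windowSign x (1 + E)                   ≡⟨ cong (windowSign x) (+-comm 1 E) ⟩
    windowSign x (E + 1)                   ≡⟨ windowSign-+ x E 1 ⟩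
    windowSign x E · windowSign (x + E) 1  ≡⟨ cong (windowSign x E ·_) (windowSign-period p x 1) ⟩
    windowSign x E · windowSign x 1        ≡⟨ ·-comm (windowSign x E) _ ⟩
    windowSign x 1 · windowSign x E        ∎)
    where open ≡-Reasoning

  windowSign-full-period : ∀ {E} → IsPeriod E → ∀ x → windowSign x E ≡ windowSign 0 E
  windowSign-full-period p zero    = refl
  windowSign-full-period p (suc x) = trans (windowSign-shift p x) (windowSign-full-period p x)

  windowSign-double-period : ∀ {E} → IsPeriod E → ∀ x → windowSign x (E + E) ≡ plus
  windowSign-double-period {E} p x =
    trans (windowSign-+ x E E)
      (trans (cong (windowSign x E ·_) (windowSign-period p x E)) (·-inverse (windowSign x E)))

  -- Start at x with rank (x + E) = 0 < rank x. Carried along one period by a window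
  -- of sign plus, this order gives rank (x + E + E) < rank (x + E) = 0.
  windowSign≢plus : ∀ E → IsPeriod E → E % n ≢ 0 → windowSign 0 E ≢ plus
  windowSign≢plus E p E%n≢0 ws≡plus = n≮0 (subst (rank (x + E + E) <_) rank[x+E]≡0 descent)
    where
    x = bottom + (E * n ∸ E)
    rank[x+E]≡0 : rank (x + E) ≡ 0
    rank[x+E]≡0 = trans (rank-cong (x + E) bottom x+E≡bottom) rank-bottom
      where
      x+E≡bottom : (x + E) % n ≡ bottom % n
      x+E≡bottom = trans
        (cong (_% n) (trans (+-assoc bottom _ E) (cong (bottom +_) (m∸n+n≡m (m≤m*n E n)))))
        ([m+kn]%n≡m%n bottom E n)
    start : rank (x + E) < rank x
    start = subst (_< rank x) (sym rank[x+E]≡0)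
      (n≢0⇒n>0 λ rank[x]≡0 → rank-+-≢ x E E%n≢0 (trans rank[x]≡0 (sym rank[x+E]≡0)))
    descent : rank (x + E + E) < rank (x + E)
    descent = subst (λ s → rank (x + E) <[ s ] rank (x + E + E))
      (cong (minus ·_) (trans (windowSign-full-period p x) ws≡plus))
      (rank-step-along minus x (x + E) E (λ l _ → sym (period-shift p x l)) start)

  Aperiodic : Set
  Aperiodic = ∀ D → D % n ≢ 0 → ¬ IsPeriod D

  -- 2D has window sign plus, so it must be a multiple of n.
  period⇒half-period : ∀ D → IsPeriod D → D % n ≢ 0 → ∃ λ r → n ≡ r + r × IsPeriod r
  period⇒half-period D p D%n≢0 with (D + D) % n ≟ 0
  ... | no 2D%n≢0 =
    ⊥-elim (windowSign≢plus (D + D) (period-+ p p) 2D%n≢0 (windowSign-double-period p 0))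
  ... | yes 2D%n≡0 with m<n+n∧m%n≡0⇒m≡0⊎m≡n n (D % n + D % n) (+-mono-< (m%n<n D n) (m%n<n D n))
                          (trans (sym (%-distribˡ-+ D D n)) 2D%n≡0)
  ...   | inj₁ 2r≡0 = ⊥-elim (D%n≢0 (m+n≡0⇒m≡0 (D % n) 2r≡0))
  ...   | inj₂ 2r≡n = D % n , sym 2r≡n ,
            λ x → trans (cong w (%≡⇒mod≡ n _ _ ([m+n%d]%d≡[m+n]%d x D n))) (p x)

  common-window⇒period : ∀ a b → a ≤ n → (∀ l → l < n → letter (a + l) ≡ letter (b + l)) →
    IsPeriod (n ∸ a + b)
  common-window⇒period a b a≤n ag x = begin
    letter (x + (n ∸ a + b)) ≡⟨ cong letter (sym b+l≡) ⟩
    letter (b + l)           ≡⟨ sym (agree l) ⟩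
    letter (a + l)           ≡⟨ cong letter a+l≡ ⟩
    letter (x + n)           ≡⟨ cong w (%≡⇒mod≡ n _ _ ([m+n]%n≡m%n x n)) ⟩
    letter x                 ∎
    where
    open ≡-Reasoning
    l = x + (n ∸ a)
    a+l≡ : a + l ≡ x + n
    a+l≡ = trans (+-comm a l) (trans (+-assoc x (n ∸ a) a) (cong (x +_) (m∸n+n≡m a≤n)))
    b+l≡ : b + l ≡ x + (n ∸ a + b)
    b+l≡ = trans (+-comm b l) (+-assoc x (n ∸ a) b)
    agree : ∀ i → letter (a + i) ≡ letter (b + i)
    agree i = begin
      letter (a + i)     ≡⟨ cong w (%≡⇒mod≡ n _ _ ([m+n%d]%d≡[m+n]%d a i n)) ⟨
      letter (a + i % n) ≡⟨ ag (i % n) (m%n<n i n) ⟩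
      letter (b + i % n) ≡⟨ cong w (%≡⇒mod≡ n _ _ ([m+n%d]%d≡[m+n]%d b i n)) ⟩
      letter (b + i)     ∎

  rank<⇒suffix≺ : Aperiodic → ∀ a b → a < n → b < n → rank a < rank b →
    suffix (periodic w) a ≺[ σ ] suffix (periodic w) b
  rank<⇒suffix≺ ap a b a<n b<n ra<rb with first-difference (suffix (periodic w) a) (suffix (periodic w) b) n
  ... | inj₁ ag =
    ⊥-elim (ap (n ∸ a + b) ([n∸a+b]%n≢0 n a b a<n b<n a≢b) (common-window⇒period a b (<⇒≤ a<n) ag))
    where
    a≢b : a ≢ b
    a≢b refl = <-irrefl refl ra<rb
  ... | inj₂ (m , ag , differ) with windowSign a m in ws | rank-step-along plus a b m ag ra<rb
  ...   | plus  | r = m , ag , inj₁ (minus^≡plus⇒even c (trans (minus^-negCount a m) ws) ,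
                        ≤∧≢⇒< (letter-mono (a + m) (b + m) (<⇒≤ r)) (λ eq → differ (toℕ-injective eq)))
    where c = negCount σ (suffix (periodic w) a) m
  ...   | minus | r = m , ag , inj₂ (minus^≡minus⇒odd c (trans (minus^-negCount a m) ws) ,
                        ≤∧≢⇒< (letter-mono (b + m) (a + m) (<⇒≤ r)) (λ eq → differ (toℕ-injective (sym eq))))
    where c = negCount σ (suffix (periodic w) a) m

  suffix≺⇒rank< : Aperiodic → ∀ a b → a < n → b < n →
    suffix (periodic w) a ≺[ σ ] suffix (periodic w) b → rank a < rank b
  suffix≺⇒rank< ap a b a<n b<n a≺b with <-cmp (rank a) (rank b)
  ... | tri< lt _ _ = lt
  ... | tri> _ _ gt = ⊥-elim (≺-asym σ _ _ a≺b (rank<⇒suffix≺ ap b a b<n a<n gt))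
  ... | tri≈ _ eq _ with trans (sym (m<n⇒m%n≡m a<n)) (trans (rank-injective a b eq) (m<n⇒m%n≡m b<n))
  ...   | refl = ⊥-elim (≺-irrefl σ _ a≺b)

  aperiodic⇒pattern : Aperiodic → PatternIs σ w π
  aperiodic⇒pattern ap i j = mk⇔
    (λ lt → rank<⇒suffix≺ ap (toℕ i) (toℕ j) (toℕ<n i) (toℕ<n j)
              (subst₂ _<_ (sym (rank-toℕ i)) (sym (rank-toℕ j)) lt))
    (λ i≺j → subst₂ _<_ (rank-toℕ i) (rank-toℕ j)
               (suffix≺⇒rank< ap (toℕ i) (toℕ j) (toℕ<n i) (toℕ<n j) i≺j))

  aperiodic⇒primitive : Aperiodic → Primitive w
  aperiodic⇒primitive ap (u , m , 2≤m , w≡uᵐ) = ap L L%n≢0 L-period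
    where
    L = length u
    n≡mL : n ≡ m * L
    n≡mL = trans (sym (length-tabulate w)) (trans (cong length w≡uᵐ) (length-concat-replicate m u))
    L≢0 : L ≢ 0
    L≢0 L≡0 = ≢-nonZero⁻¹ n (trans n≡mL (trans (cong (m *_) L≡0) (*-zeroʳ m)))
    instance
      _ : NonZero L
      _ = ≢-nonZero L≢0
    L<n : L < n
    L<n = subst (L <_) (trans (*-comm L m) (sym n≡mL)) (m<m*n L m 2≤m)
    L%n≢0 : L % n ≢ 0
    L%n≢0 L%n≡0 = L≢0 (trans (sym (m<n⇒m%n≡m L<n)) L%n≡0)
    at-u : ∀ x → at u (x % L) ≡ just (letter x)
    at-u x = sym (begin
      just (letter x)                      ≡⟨ at-tabulate w (x % n) (m%n<n x n) ⟨
      at (tabulate w) (x % n)              ≡⟨ cong (λ l → at l (x % n)) w≡uᵐ ⟩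
      at (concat (replicate m u)) (x % n)  ≡⟨ at-concat-replicate m u (x % n) x%n<mL ⟩
      at u (x % n % L)                     ≡⟨ cong (at u) (m∣n⇒o%n%m≡o%m L n x (divides m n≡mL)) ⟩
      at u (x % L)                         ∎)
      where
      open ≡-Reasoning
      x%n<mL = subst (x % n <_) n≡mL (m%n<n x n)
    L-period : IsPeriod L
    L-period x = just-injective (trans (sym (at-u (x + L))) (trans (cong (at u) ([m+n]%n≡m%n x L)) (at-u x)))

  aperiodic⇒primitive×pattern : Aperiodic → Primitive w × PatternIs σ w π
  aperiodic⇒primitive×pattern ap = aperiodic⇒primitive ap , aperiodic⇒pattern ap

  windowSign-allPlus : AllPlus σ → ∀ x L → windowSign x L ≡ plus
  windowSign-allPlus all+ x zero    = refl
  windowSign-allPlus all+ x (suc L) = cong₂ _·_ (windowSign-allPlus all+ x L) (all+ _)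

  windowSign-allMinus : AllMinus σ → ∀ x L → windowSign x L ≡ minus^ L
  windowSign-allMinus all- x zero    = refl
  windowSign-allMinus all- x (suc L) =
    trans (cong₂ _·_ (windowSign-allMinus all- x L) (all- _)) (·-comm (minus^ L) minus)

  allPlus⇒aperiodic : AllPlus σ → Aperiodic
  allPlus⇒aperiodic all+ D D%n≢0 p with period⇒half-period D p D%n≢0
  ... | r , n≡r+r , pr = windowSign≢plus r pr (m+m≡n⇒m%n≢0 n r n≡r+r) (windowSign-allPlus all+ 0 r)

  allMinus⇒aperiodic : AllMinus σ → n % 4 ≢ 2 → Aperiodic
  allMinus⇒aperiodic all- n%4≢2 D D%n≢0 p with period⇒half-period D p D%n≢0
  ... | r , n≡r+r , pr with minus^ r in ws
  ...   | plus  =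
    windowSign≢plus r pr (m+m≡n⇒m%n≢0 n r n≡r+r) (trans (windowSign-allMinus all- 0 r) ws)
  ...   | minus = n%4≢2 (trans (cong (_% 4) n≡r+r) (odd⇒[m+m]%4≡2 r (minus^≡minus⇒odd r ws)))

inducedWord : ∀ {k n} .{{_ : NonZero n}} {σ : SignSeq k} (π : Permutation′ n) (e : Fin (suc k) → ℕ) →
  IsSegmentation σ (hat π) e → Word k n
inducedWord {σ = σ} π e seg i =
  proj₁ (Segmentation.segmentation-covers σ (hat π) e seg (toℕ (π ⟨$⟩ʳ i)) (toℕ<n _))

inducedWord-isInduced : ∀ {k n} .{{_ : NonZero n}} {σ : SignSeq k} (π : Permutation′ n)
  (e : Fin (suc k) → ℕ) (seg : IsSegmentation σ (hat π) e) → IsInducedWord π e (inducedWord π e seg)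
inducedWord-isInduced {σ = σ} π e seg i t lo hi = InBlock-unique e segmentation-ascending
  (proj₂ (segmentation-covers (toℕ (π ⟨$⟩ʳ i)) (toℕ<n _))) (lo , hi)
  where open Segmentation σ (hat π) e seg

MonotoneOn : ∀ {n} → Sign → (Fin n → Fin n) → ℕ → ℕ → Set
MonotoneOn s τ a b = ∀ p q → a ≤ toℕ p → toℕ p < toℕ q → toℕ q < b → MonoBlock s τ p q

MonotoneAt : ∀ {n} → Sign → (Fin n → Fin n) → ℕ → Set
MonotoneAt s τ m = ∀ p q → suc (toℕ p) ≡ m → toℕ q ≡ m → MonoBlock s τ p q

MonotoneAt-intro : ∀ {n} s (τ : Fin n → Fin n) (p q : Fin n) → suc (toℕ p) ≡ toℕ q →
  MonoBlock s τ p q → MonotoneAt s τ (toℕ q)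
MonotoneAt-intro s τ p q p+1≡q mb p′ q′ p′+1≡q q′≡q
  with toℕ-injective {i = p′} {j = p} (suc-injective (trans p′+1≡q (sym p+1≡q))) | toℕ-injective q′≡q
... | refl | refl = mb

MonoBlock-trans : ∀ {n} s (τ : Fin n → Fin n) p q r →
  MonoBlock s τ p q → MonoBlock s τ q r → MonoBlock s τ p r
MonoBlock-trans s τ p q r pq qr =
  <[]⇒MonoBlock s τ p r (<[]-trans s (MonoBlock⇒<[] s τ p q pq) (MonoBlock⇒<[] s τ q r qr))

MonotoneOn-shrinkˡ : ∀ {n} s (τ : Fin n → Fin n) {a a′ b} → a ≤ a′ →
  MonotoneOn s τ a b → MonotoneOn s τ a′ b
MonotoneOn-shrinkˡ s τ a≤a′ mono p q lo pq hi = mono p q (≤-trans a≤a′ lo) pq hi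

MonotoneOn-shrinkʳ : ∀ {n} s (τ : Fin n → Fin n) {a b b′} → b′ ≤ b →
  MonotoneOn s τ a b → MonotoneOn s τ a b′
MonotoneOn-shrinkʳ s τ b′≤b mono p q lo pq hi = mono p q lo pq (<-≤-trans hi b′≤b)

MonotoneOn-extendʳ : ∀ {n} s (τ : Fin n → Fin n) a b → MonotoneOn s τ a b → (a < b → MonotoneAt s τ b) →
  MonotoneOn s τ a (suc b)
MonotoneOn-extendʳ {n} s τ a b mono at p q lo pq hi with toℕ q <? b
... | yes q<b = mono p q lo pq q<b
... | no  q≮b with suc (toℕ p) ≟ b
...   | yes p+1≡b = at (≤-<-trans lo (<-≤-trans pq (s≤s⁻¹ hi))) p q p+1≡b q≡b
  where q≡b = ≤-antisym (s≤s⁻¹ hi) (≮⇒≥ q≮b)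
...   | no  p+1≢b = MonoBlock-trans s τ p p′ q (mono p p′ lo p<p′ p′<b)
                      (at (≤-<-trans lo (<-trans p<p′ p′<b)) p′ q p′+1≡b q≡b)
  where
  q≡b = ≤-antisym (s≤s⁻¹ hi) (≮⇒≥ q≮b)
  p+1<b : suc (toℕ p) < b
  p+1<b = ≤∧≢⇒< (subst (toℕ p <_) q≡b pq) p+1≢b
  b∸1<n : b ∸ 1 < n
  b∸1<n = ≤-<-trans (m∸n≤m b 1) (subst (_< n) q≡b (toℕ<n q))
  p′ : Fin n
  p′ = fromℕ< b∸1<n
  p′+1≡b : suc (toℕ p′) ≡ b
  p′+1≡b = trans (cong suc (toℕ-fromℕ< b∸1<n)) (m+[n∸m]≡n {1} {b} (≤-trans (s≤s z≤n) (<⇒≤ p+1<b)))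
  p<p′ : toℕ p < toℕ p′
  p<p′ = subst (toℕ p <_) (sym (toℕ-fromℕ< b∸1<n)) (∸-monoˡ-≤ 1 p+1<b)
  p′<b : toℕ p′ < b
  p′<b = subst (toℕ p′ <_) p′+1≡b (n<1+n (toℕ p′))

MonotoneOn-extendˡ : ∀ {n} s (τ : Fin n → Fin n) a b → MonotoneOn s τ (suc a) b →
  (suc a < b → MonotoneAt s τ (suc a)) → MonotoneOn s τ a b
MonotoneOn-extendˡ {n} s τ a b mono at p q lo pq hi with a <? toℕ p
... | yes a<p = mono p q a<p pq hi
... | no  a≮p with toℕ q ≟ suc a
...   | yes q≡a+1 = at (subst (_< b) q≡a+1 hi) p q (cong suc p≡a) q≡a+1
  where p≡a = ≤-antisym (≮⇒≥ a≮p) lo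
...   | no  q≢a+1 = MonoBlock-trans s τ p q′ q
                      (at (subst (_< b) q′≡a+1 (<-trans q′<q hi)) p q′ (cong suc p≡a) q′≡a+1)
                      (mono q′ q (≤-reflexive (sym q′≡a+1)) q′<q hi)
  where
  p≡a = ≤-antisym (≮⇒≥ a≮p) lo
  a+1<q : suc a < toℕ q
  a+1<q = ≤∧≢⇒< (subst (_< toℕ q) p≡a pq) (λ eq → q≢a+1 (sym eq))
  a+1<n : suc a < n
  a+1<n = <-trans a+1<q (toℕ<n q)
  q′ : Fin n
  q′ = fromℕ< a+1<n
  q′≡a+1 : toℕ q′ ≡ suc a
  q′≡a+1 = toℕ-fromℕ< a+1<n
  q′<q : toℕ q′ < toℕ q
  q′<q = subst (_< toℕ q) (sym q′≡a+1) a+1<q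

-- Blocks inject₁ t and suc t are adjacent; the boundary between them has index suc (inject₁ t).
module BoundaryShift {k n} (σ : SignSeq (suc k)) (τ : Fin n → Fin n) (e : Fin (suc (suc k)) → ℕ)
  (t : Fin k) (c : ℕ) where

  left right : Fin (suc k)
  left  = inject₁ t
  right = F.suc t

  e′ : Fin (suc (suc k)) → ℕ
  e′ = updateAt e (F.suc left) (const c)

  left≢right : left ≢ right
  left≢right eq = 1+n≢n (sym (trans (sym (toℕ-inject₁ t)) (cong toℕ eq)))

  e′-left : e′ (inject₁ left) ≡ e (inject₁ left)
  e′-left = updateAt-minimal _ _ e λ eq → 1+n≢n (begin
    suc (toℕ t)          ≡⟨ cong suc (toℕ-inject₁ t) ⟨
    toℕ (F.suc left)     ≡⟨ cong toℕ eq ⟨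
    toℕ (inject₁ left)   ≡⟨ toℕ-inject₁ left ⟩
    toℕ left             ≡⟨ toℕ-inject₁ t ⟩
    toℕ t                ∎)
    where open ≡-Reasoning

  e′-boundary : e′ (F.suc left) ≡ c
  e′-boundary = updateAt-updates (F.suc left) e

  e′-right : e′ (F.suc right) ≡ e (F.suc right)
  e′-right = updateAt-minimal _ _ e λ eq → left≢right (sym (FinP.suc-injective eq))

  block-cases : ∀ u →
    u ≡ left ⊎ u ≡ right ⊎ (e′ (inject₁ u) ≡ e (inject₁ u) × e′ (F.suc u) ≡ e (F.suc u))
  block-cases u with F.suc u F.≟ F.suc left | inject₁ u F.≟ F.suc left
  ... | yes eq  | _       = inj₁ (FinP.suc-injective eq)
  ... | no  _   | yes eq  = inj₂ (inj₁ (inject₁-injective eq))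
  ... | no  ne₁ | no  ne₂ = inj₂ (inj₂ (updateAt-minimal _ _ e ne₂ , updateAt-minimal _ _ e ne₁))

  shifted-isSegmentation : IsSegmentation σ τ e →
    e (inject₁ left) ≤ c → MonotoneOn (σ left) τ (e (inject₁ left)) c →
    c ≤ e (F.suc right) → MonotoneOn (σ right) τ c (e (F.suc right)) →
    IsSegmentation σ τ e′
  shifted-isSegmentation (e₀≡0 , eₖ≡n , asc , mono) left≤c monoˡ c≤right monoʳ =
    trans (updateAt-minimal F.zero (F.suc left) {const c} e λ ()) e₀≡0 ,
    trans (updateAt-minimal (fromℕ (suc k)) (F.suc left) {const c} e
             λ eq → fromℕ≢inject₁ (FinP.suc-injective eq)) eₖ≡n ,
    asc′ , mono′
    where
    asc′ : Ascending e′
    asc′ u with block-cases u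
    ... | inj₁ refl               = subst₂ _≤_ (sym e′-left) (sym e′-boundary) left≤c
    ... | inj₂ (inj₁ refl)        = subst₂ _≤_ (sym e′-boundary) (sym e′-right) c≤right
    ... | inj₂ (inj₂ (lo≡ , hi≡)) = subst₂ _≤_ (sym lo≡) (sym hi≡) (asc u)
    mono′ : ∀ u → MonotoneOn (σ u) τ (e′ (inject₁ u)) (e′ (F.suc u))
    mono′ u with block-cases u
    ... | inj₁ refl               = subst₂ (MonotoneOn (σ left) τ) (sym e′-left) (sym e′-boundary) monoˡ
    ... | inj₂ (inj₁ refl)        = subst₂ (MonotoneOn (σ right) τ) (sym e′-boundary) (sym e′-right) monoʳ
    ... | inj₂ (inj₂ (lo≡ , hi≡)) = subst₂ (MonotoneOn (σ u) τ) (sym lo≡) (sym hi≡) (mono u)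

record Detachment {k n} (σ : SignSeq k) (τ : Fin n → Fin n) (e : Fin (suc k) → ℕ) : Set where
  field
    point                : ℕ
    boundaries           : Fin (suc k) → ℕ
    isSegmentation       : IsSegmentation σ τ boundaries
    pointBlock restBlock : Fin k
    pointBlock≢restBlock : pointBlock ≢ restBlock
    point∈pointBlock     : InBlock boundaries pointBlock point
    rest∈restBlock       : ∀ {u y} → InBlock e u point → InBlock e u y → y ≢ point →
                           InBlock boundaries restBlock y

change-from-zero : ∀ {k} (P : Fin (suc k) → Set) → (∀ u → Dec (P u)) → ∀ j → P F.zero → ¬ P j →
  ∃ λ t → P (inject₁ t) × ¬ P (F.suc t)
change-from-zero P P? F.zero p₀ ¬pⱼ = ⊥-elim (¬pⱼ p₀)
change-from-zero {suc k} P P? (F.suc j) p₀ ¬pⱼ with P? (F.suc F.zero)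
... | no  ¬p₁ = F.zero , p₀ , ¬p₁
... | yes p₁ with change-from-zero (P ∘ F.suc) (P? ∘ F.suc) j p₁ ¬pⱼ
...   | t , pₜ , ¬pₜ₊₁ = F.suc t , pₜ , ¬pₜ₊₁

adjacent-change : ∀ {k} (P : Fin (suc k) → Set) → (∀ u → Dec (P u)) → ∀ i j → P i → ¬ P j →
  ∃ λ t → (P (inject₁ t) × ¬ P (F.suc t)) ⊎ (¬ P (inject₁ t) × P (F.suc t))
adjacent-change P P? i j pᵢ ¬pⱼ with P? F.zero
... | yes p₀ = map₂ inj₁ (change-from-zero P P? j p₀ ¬pⱼ)
... | no ¬p₀ with change-from-zero (¬_ ∘ P) (¬? ∘ P?) i ¬p₀ (λ ¬pᵢ → ¬pᵢ pᵢ)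
...   | t , ¬pₜ , ¬¬pₜ₊₁ = t , inj₂ (¬pₜ , decidable-stable (P? (F.suc t)) ¬¬pₜ₊₁)

all-empty⇒e₀≡eₖ : ∀ {k} (e : Fin (suc k) → ℕ) → (∀ u → e (inject₁ u) ≡ e (F.suc u)) →
  e F.zero ≡ e (fromℕ k)
all-empty⇒e₀≡eₖ {zero}  e empty = refl
all-empty⇒e₀≡eₖ {suc k} e empty = trans (empty F.zero) (all-empty⇒e₀≡eₖ (e ∘ F.suc) (empty ∘ F.suc))

module Detach {k n} (σ : SignSeq (suc k)) (τ : Fin n → Fin n) (e : Fin (suc (suc k)) → ℕ)
  (seg : IsSegmentation σ τ e) where

  open Segmentation σ τ e seg

  first-of-right-to-left : (t : Fin k) → e (F.suc (inject₁ t)) < e (F.suc (F.suc t)) →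
    (e (inject₁ (inject₁ t)) < e (F.suc (inject₁ t)) → MonotoneAt (σ (inject₁ t)) τ (e (F.suc (inject₁ t)))) →
    Detachment σ τ e
  first-of-right-to-left t right≢∅ extend = record
    { point                = v
    ; boundaries           = e′
    ; isSegmentation       = shifted-isSegmentation seg (≤-trans (asc left) (n≤1+n v))
                               (MonotoneOn-extendʳ (σ left) τ _ v (mono left) extend)
                               right≢∅ (MonotoneOn-shrinkˡ (σ right) τ (n≤1+n v) (mono right))
    ; pointBlock           = left
    ; restBlock            = right
    ; pointBlock≢restBlock = left≢right
    ; point∈pointBlock     = subst (_≤ v) (sym e′-left) (asc left) ,
                             subst (v <_) (sym e′-boundary) (n<1+n v)
    ; rest∈restBlock       = rest
    }
    where
    v = e (F.suc (inject₁ t))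
    open BoundaryShift σ τ e t (suc v)
    asc  = segmentation-ascending
    mono = segmentation-monotone
    rest : ∀ {u y} → InBlock e u v → InBlock e u y → y ≢ v → InBlock e′ right y
    rest u∋v (v≤y , y<) y≢v with InBlock-unique e asc u∋v (≤-refl , right≢∅)
    ... | refl = subst (_≤ _) (sym e′-boundary) (≤∧≢⇒< v≤y (λ eq → y≢v (sym eq))) ,
                 subst (_ <_) (sym e′-right) y<

  last-of-left-to-right : (t : Fin k) → e (inject₁ (inject₁ t)) < e (F.suc (inject₁ t)) →
    (e (F.suc (inject₁ t)) < e (F.suc (F.suc t)) → MonotoneAt (σ (F.suc t)) τ (e (F.suc (inject₁ t)))) →
    Detachment σ τ e
  last-of-left-to-right t left≢∅ extend = record
    { point                = v
    ; boundaries           = e′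
    ; isSegmentation       = shifted-isSegmentation seg (∸-monoˡ-≤ 1 left≢∅)
                               (MonotoneOn-shrinkʳ (σ left) τ (m∸n≤m b 1) (mono left))
                               (≤-trans (m∸n≤m b 1) (asc right)) monoʳ
    ; pointBlock           = right
    ; restBlock            = left
    ; pointBlock≢restBlock = λ eq → left≢right (sym eq)
    ; point∈pointBlock     = subst (_≤ v) (sym e′-boundary) ≤-refl ,
                             subst (v <_) (sym e′-right) (<-≤-trans v<b (asc right))
    ; rest∈restBlock       = rest
    }
    where
    b = e (F.suc (inject₁ t))
    v = b ∸ 1
    open BoundaryShift σ τ e t v
    asc  = segmentation-ascending
    mono = segmentation-monotone
    v+1≡b : suc v ≡ b
    v+1≡b = m+[n∸m]≡n {1} {b} (≤-trans (s≤s z≤n) left≢∅)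
    v<b : v < b
    v<b = subst (v <_) v+1≡b (n<1+n v)
    monoʳ : MonotoneOn (σ right) τ v (e (F.suc right))
    monoʳ = MonotoneOn-extendˡ (σ right) τ v (e (F.suc right))
      (subst (λ z → MonotoneOn (σ right) τ z (e (F.suc right))) (sym v+1≡b) (mono right))
      (λ lt → subst (MonotoneAt (σ right) τ) (sym v+1≡b) (extend (subst (_< e (F.suc right)) v+1≡b lt)))
    rest : ∀ {u y} → InBlock e u v → InBlock e u y → y ≢ v → InBlock e′ left y
    rest u∋v (lo , y<) y≢v with InBlock-unique e asc u∋v (∸-monoˡ-≤ 1 left≢∅ , v<b)
    ... | refl = subst (_≤ _) (sym e′-left) lo ,
                 subst (_ <_) (sym e′-boundary) (≤∧≢⇒< (s≤s⁻¹ (subst (_ <_) (sym v+1≡b) y<)) y≢v)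

  next-to-empty : 0 < n → ∀ u → e (inject₁ u) ≡ e (F.suc u) → Detachment σ τ e
  next-to-empty 0<n u u∅ with all? (λ u → e (inject₁ u) ≟ e (F.suc u))
  ... | yes all∅ =
    ⊥-elim (<-irrefl (trans (sym (proj₁ seg)) (trans (all-empty⇒e₀≡eₖ e all∅) (proj₁ (proj₂ seg)))) 0<n)
  ... | no ¬all∅ with ¬∀⟶∃¬ _ _ (λ u → e (inject₁ u) ≟ e (F.suc u)) ¬all∅
  ...   | u′ , u′≢∅ with adjacent-change _ (λ u → e (inject₁ u) ≟ e (F.suc u)) u u′ u∅ u′≢∅
  ...     | t , inj₁ (left∅ , right≢∅) = first-of-right-to-left t (≤∧≢⇒< (segmentation-ascending _) right≢∅)
                                           (λ lt → ⊥-elim (<-irrefl left∅ lt))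
  ...     | t , inj₂ (left≢∅ , right∅) = last-of-left-to-right t (≤∧≢⇒< (segmentation-ascending _) left≢∅)
                                           (λ lt → ⊥-elim (<-irrefl right∅ lt))

  -- Of the two positions around the boundary, τ orders them according to one of the two
  -- (opposite) signs; the corresponding block can absorb the neighbouring position.
  between-signs : (∀ a b → τ a ≡ τ b → a ≡ b) → (t : Fin k) → σ (inject₁ t) ≢ σ (F.suc t) →
    e (inject₁ (inject₁ t)) < e (F.suc (inject₁ t)) → e (F.suc (inject₁ t)) < e (F.suc (F.suc t)) →
    Detachment σ τ e
  between-signs τ-inj t σ≢ left≢∅ right≢∅ =
    [ (λ ord → first-of-right-to-left t right≢∅ (λ _ → monotone-at-b (σ (inject₁ t)) ord))
    , (λ ord → last-of-left-to-right t left≢∅ (λ _ → monotone-at-b (σ (F.suc t)) ord))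
    ]′ (<[]-total (σ (inject₁ t)) (σ (F.suc t)) σ≢ τp≢τq)
    where
    b = e (F.suc (inject₁ t))
    b<n : b < n
    b<n = InBlock⇒<n {F.suc t} (≤-refl , right≢∅)
    b∸1<n : b ∸ 1 < n
    b∸1<n = ≤-<-trans (m∸n≤m b 1) b<n
    p q : Fin n
    p = fromℕ< b∸1<n
    q = fromℕ< b<n
    p+1≡q : suc (toℕ p) ≡ toℕ q
    p+1≡q = trans (cong suc (toℕ-fromℕ< b∸1<n))
      (trans (m+[n∸m]≡n {1} {b} (≤-trans (s≤s z≤n) left≢∅)) (sym (toℕ-fromℕ< b<n)))
    τp≢τq : toℕ (τ p) ≢ toℕ (τ q)
    τp≢τq eq = 1+n≢n (trans p+1≡q (cong toℕ (sym (τ-inj p q (toℕ-injective eq)))))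
    monotone-at-b : ∀ s → toℕ (τ p) <[ s ] toℕ (τ q) → MonotoneAt s τ b
    monotone-at-b s ord = subst (MonotoneAt s τ) (toℕ-fromℕ< b<n)
      (MonotoneAt-intro s τ p q p+1≡q (<[]⇒MonoBlock s τ p q ord))

  detach : (∀ a b → τ a ≡ τ b → a ≡ b) → 0 < n →
    (∃ λ u → σ u ≡ plus) → (∃ λ u → σ u ≡ minus) → Detachment σ τ e
  detach τ-inj 0<n (i , σᵢ≡plus) (j , σⱼ≡minus) with any? (λ u → e (inject₁ u) ≟ e (F.suc u))
  ... | yes (u , u∅) = next-to-empty 0<n u u∅
  ... | no ∄∅ with adjacent-change (λ u → σ u ≡ plus) (λ u → σ u ≟ˢ plus) i j σᵢ≡plus 
                  (λ σⱼ≡plus → plus≢minus (trans (sym σⱼ≡plus) σⱼ≡minus))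
  ...   | t , change =
    between-signs τ-inj t (sign-changes change) (nonempty (inject₁ t)) (nonempty (F.suc t))
    where
    nonempty : ∀ u → e (inject₁ u) < e (F.suc u)
    nonempty u = ≤∧≢⇒< (segmentation-ascending u) (λ u∅ → ∄∅ (u , u∅))
    sign-changes : (σ (inject₁ t) ≡ plus × σ (F.suc t) ≢ plus) ⊎ (σ (inject₁ t) ≢ plus × σ (F.suc t) ≡ plus)
                 → σ (inject₁ t) ≢ σ (F.suc t)
    sign-changes (inj₁ (l , ¬r)) eq = ¬r (trans (sym eq) l)
    sign-changes (inj₂ (¬l , r)) eq = ¬l (trans eq r)

-- Adding n ∸ 1 undoes the successor modulo n.
cycSuc-injective : ∀ {n} .{{_ : NonZero n}} (i j : Fin n) → cycSuc i ≡ cycSuc j → i ≡ j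
cycSuc-injective {n} i j eq = toℕ-injective (begin
    toℕ i                        ≡⟨ m<n⇒m%n≡m (toℕ<n i) ⟨
    toℕ i % n                    ≡⟨ [m+n]%n≡m%n (toℕ i) n ⟨
    (toℕ i + n) % n              ≡⟨ cong (_% n) (1+m+[n∸1]≡m+n (toℕ i)) ⟨
    (suc (toℕ i) + (n ∸ 1)) % n  ≡⟨ [m+n]%d≡[o+n]%d (suc (toℕ i)) (suc (toℕ j)) (n ∸ 1) n i+1≡j+1 ⟩
    (suc (toℕ j) + (n ∸ 1)) % n  ≡⟨ cong (_% n) (1+m+[n∸1]≡m+n (toℕ j)) ⟩
    (toℕ j + n) % n              ≡⟨ [m+n]%n≡m%n (toℕ j) n ⟩
    toℕ j % n                    ≡⟨ m<n⇒m%n≡m (toℕ<n j) ⟩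
    toℕ j                        ∎)
  where
  open ≡-Reasoning
  i+1≡j+1 : suc (toℕ i) % n ≡ suc (toℕ j) % n
  i+1≡j+1 = trans (sym (toℕ-mod n _)) (trans (cong toℕ eq) (toℕ-mod n _))
  1+m+[n∸1]≡m+n : ∀ m → suc m + (n ∸ 1) ≡ m + n
  1+m+[n∸1]≡m+n m = trans (sym (+-suc m (n ∸ 1))) (cong (m +_) (m+[n∸m]≡n {1} {n} (>-nonZero⁻¹ n)))

hat-injective : ∀ {n} .{{_ : NonZero n}} (π : Permutation′ n) a b → hat π a ≡ hat π b → a ≡ b
hat-injective π a b eq =
  trans (sym (inverseʳ π)) (trans (cong (π ⟨$⟩ʳ_) (cycSuc-injective _ _ cyc≡)) (inverseʳ π))
  where
  cyc≡ = trans (sym (inverseˡ π)) (trans (cong (π ⟨$⟩ˡ_) eq) (inverseˡ π))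

Realization : ∀ {k n} .{{_ : NonZero n}} → SignSeq k → Permutation′ n → Set
Realization {k} {n} σ π = ∃ λ e → IsSegmentation σ (hat π) e ×
  Σ (Word k n) λ w → IsInducedWord π e w × Primitive w × PatternIs σ w π

realization : ∀ {k n} .{{_ : NonZero n}} (σ : SignSeq k) (π : Permutation′ n) e
  (seg : IsSegmentation σ (hat π) e) →
  Primitive (inducedWord π e seg) × PatternIs σ (inducedWord π e seg) π → Realization σ π
realization σ π e seg prim×pat = e , seg , inducedWord π e seg , inducedWord-isInduced π e seg , prim×pat

module MixedSigns {k n} .{{_ : NonZero n}} (σ : SignSeq (suc k)) (π : Permutation′ n)
  (e : Fin (suc (suc k)) → ℕ) (seg : IsSegmentation σ (hat π) e) where

  open Segmented σ π e seg (inducedWord π e seg) (inducedWord-isInduced π e seg)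

  HalfPeriodic : Set
  HalfPeriodic = ∀ (a : Fin n) → letter (toℕ a + n / 2) ≡ letter (toℕ a)

  ¬halfPeriodic⇒aperiodic : ¬ HalfPeriodic → Aperiodic
  ¬halfPeriodic⇒aperiodic ¬half D D%n≢0 p with period⇒half-period D p D%n≢0
  ... | r , n≡r+r , r-period =
    ¬half λ a → subst (λ z → letter (toℕ a + z) ≡ letter (toℕ a))
                      (m+m≡n⇒m≡n/2 n r n≡r+r) (r-period (toℕ a))

  -- The point x₀ and x₀ + n/2 lie in the same old block but in different new blocks,
  -- so the new word is not n/2-periodic.
  module _ (half : HalfPeriodic) (d : Detachment σ (hat π) e) where
    open Detachment d
    module New = Segmented σ π boundaries isSegmentation
      (inducedWord π boundaries isSegmentation) (inducedWord-isInduced π boundaries isSegmentation)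

    detached-aperiodic : New.Aperiodic
    detached-aperiodic D D%n≢0 p with New.period⇒half-period D p D%n≢0
    ... | r , n≡r+r , r-period =
      pointBlock≢restBlock (trans (sym x₀∈point) (trans (sym (r-period x₀)) x₀+r∈rest))
      where
      point<n : point < n
      point<n = Segmentation.InBlock⇒<n σ (hat π) boundaries isSegmentation point∈pointBlock
      x₀ = toℕ (π ⟨$⟩ˡ fromℕ< point<n)
      rank-x₀ : rank x₀ ≡ point
      rank-x₀ = trans (rank-toℕ _) (trans (cong toℕ (inverseʳ π)) (toℕ-fromℕ< point<n))
      y = rank (x₀ + r)
      y≢point : y ≢ point
      y≢point y≡point = rank-+-≢ x₀ r (m+m≡n⇒m%n≢0 n r n≡r+r) (trans rank-x₀ (sym y≡point))
      same-old-letter : letter (x₀ + r) ≡ letter x₀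
      same-old-letter =
        subst (λ z → letter (x₀ + z) ≡ letter x₀) (sym (m+m≡n⇒m≡n/2 n r n≡r+r)) (half _)
      y∈rest : InBlock boundaries restBlock y
      y∈rest = rest∈restBlock (subst (InBlock e (letter x₀)) rank-x₀ (rank∈block x₀))
        (subst (λ u → InBlock e u y) same-old-letter (rank∈block (x₀ + r))) y≢point
      asc′ = Segmentation.segmentation-ascending σ (hat π) boundaries isSegmentation
      x₀∈point : New.letter x₀ ≡ pointBlock
      x₀∈point = InBlock-unique boundaries asc′
        (subst (InBlock boundaries (New.letter x₀)) rank-x₀ (New.rank∈block x₀)) point∈pointBlock
      x₀+r∈rest : New.letter (x₀ + r) ≡ restBlock
      x₀+r∈rest = InBlock-unique boundaries asc′ (New.rank∈block (x₀ + r)) y∈rest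

  mixed-realization : (∃ λ u → σ u ≡ plus) → (∃ λ u → σ u ≡ minus) → Realization σ π
  mixed-realization +∈σ -∈σ with all? (λ (a : Fin n) → letter (toℕ a + n / 2) F.≟ letter (toℕ a))
  ... | no ¬half = realization σ π e seg (aperiodic⇒primitive×pattern (¬halfPeriodic⇒aperiodic ¬half))
  ... | yes half = realization σ π boundaries isSegmentation
                     (New.aperiodic⇒primitive×pattern half d (detached-aperiodic half d))
    where
    d = Detach.detach σ (hat π) e seg (hat-injective π) (>-nonZero⁻¹ n) +∈σ -∈σ
    open Detachment d

lemma2p5 : (k n : ℕ) .{{_ : NonZero n}} → 2 ≤ k → (σ : SignSeq k) →
    (AllMinus σ → ¬ (n % 4 ≡ 2)) →
    (π : Permutation′ n) → InC σ (hat π) →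
    (∃ λ e → IsSegmentation σ (hat π) e ×
      Σ (Word k n) λ w → IsInducedWord π e w × Primitive w × PatternIs σ w π) ×
    ((AllPlus σ ⊎ AllMinus σ) →
      ∀ e → IsSegmentation σ (hat π) e →
      ∀ (w : Word k n) → IsInducedWord π e w → Primitive w × PatternIs σ w π)
-- π̂ is a single cycle by construction.
lemma2p5 (suc k) n _ σ n%4≢2 π (_ , e , seg) = existence , universality
  where
  universality : (AllPlus σ ⊎ AllMinus σ) → ∀ e → IsSegmentation σ (hat π) e →
    ∀ (w : Word (suc k) n) → IsInducedWord π e w → Primitive w × PatternIs σ w π
  universality (inj₁ all+) e′ seg′ w ind = aperiodic⇒primitive×pattern (allPlus⇒aperiodic all+)
    where open Segmented σ π e′ seg′ w ind
  universality (inj₂ all-) e′ seg′ w ind =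
    aperiodic⇒primitive×pattern (allMinus⇒aperiodic all- (n%4≢2 all-))
    where open Segmented σ π e′ seg′ w ind

  uniform : AllPlus σ ⊎ AllMinus σ → Realization σ π
  uniform all± = realization σ π e seg (universality all± e seg _ (inducedWord-isInduced π e seg))

  existence : Realization σ π
  existence with all? (λ t → σ t ≟ˢ plus) | all? (λ t → σ t ≟ˢ minus)
  ... | yes all+ | _        = uniform (inj₁ all+)
  ... | no _     | yes all- = uniform (inj₂ all-)
  ... | no ¬all+ | no ¬all- = MixedSigns.mixed-realization σ π e seg
    (map₂ ≢minus⇒≡plus (¬∀⟶∃¬ _ _ (λ t → σ t ≟ˢ minus) ¬all-))
    (map₂ ≢plus⇒≡minus (¬∀⟶∃¬ _ _ (λ t → σ t ≟ˢ plus) ¬all+))
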